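{- Let $p$ be an acceptable prime for a strong divisibility sequence $C$, with an integer $s(p)\ge1$ as in the definition of acceptable. Then for any integer $n\ge0$, \[ \nu_p(n!_C)=\sum_{1\le k\le s(p)}\left\lfloor\frac{n}{\alpha(p^k)}\right\rfloor+\nu_p\!\left(\left\lfloor\frac{n}{\alpha(p^{s(p)})}\right\rfloor!\right). \]
   Context: A strong divisibility sequence is a sequence $C=C_1,C_2,\dots$ of nonzero integers with $\gcd(C_n,C_m)=C_{\gcd(n,m)}$ for all positive $n,m$. The $C$-orial is $0!_C=1$, $n!_C=C_nC_{n-1}\cdots C_1$ for $n\ge1$. $\nu_p$ is the $p$-adic valuation. The rank of apparition $\alpha(m)$ is the least index $j\ge1$ with $m\mid C_j$ (if it exists). When $\alpha(p^k)$ exists for all $k\ge1$, set $a_k(p)=\alpha(p^k)/\alpha(p^{k-1})$ for $k\ge2$. The prime $p$ is acceptable for $C$ if $\alpha(p^k)$ exists for all $k\ge1$ and there is an integer $s(p)\ge1$ such that $a_k(p)$ is a (positive) integer for $2\le k\le s(p)$ and $a_k(p)=p$ for $k>s(p)$. -}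

module Defs where

open import Data.Nat using (ℕ; zero; suc; _+_; _*_; _^_; _≤_; _<_)
open import Data.Nat.DivMod using (_/_)
import Data.Nat.GCD as ℕG
open import Data.Integer as ℤ using (ℤ; +_)
open import Data.Integer.Divisibility as ℤD using ()
open import Data.Integer.GCD as ℤG using ()
open import Data.Product using (_×_)
open import Relation.Nullary using (¬_)
open import Relation.Binary.PropositionalEquality using (_≡_; _≢_)

-- A sequence C₁, C₂, … of integers is modelled as C : ℕ → ℤ; the value C 0 is ignored.
-- Since gcd is nonnegative, the equation is read up to sign: gcd(C n, C m) = |C_{gcd(n,m)}|.
IsStrongDivSeq : (ℕ → ℤ) → Set
IsStrongDivSeq C =
  ((n : ℕ) → 1 ≤ n → C n ≢ + 0) ×
  ((n m : ℕ) → 1 ≤ n → 1 ≤ m → ℤG.gcd (C n) (C m) ≡ + ℤ.∣ C (ℕG.gcd n m) ∣)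

corial : (ℕ → ℤ) → ℕ → ℤ
corial C zero = + 1
corial C (suc n) = C (suc n) ℤ.* corial C n

fact : ℕ → ℕ
fact zero = 1
fact (suc n) = suc n * fact n

IsValuation : ℕ → ℤ → ℕ → Set
IsValuation p x v = (+ (p ^ v) ℤD.∣ x) × ¬ (+ (p ^ suc v) ℤD.∣ x)

IsRankOfApparition : (ℕ → ℤ) → ℕ → ℕ → Set
IsRankOfApparition C m j =
  (1 ≤ j) × (+ m ℤD.∣ C j) × ((i : ℕ) → 1 ≤ i → i < j → ¬ (+ m ℤD.∣ C i))

-- Floor division ⌊n / d⌋ (only used with d ≥ 1; the value for d = 0 is an arbitrary convention).
fdiv : ℕ → ℕ → ℕ
fdiv n zero = 0
fdiv n (suc d) = n / suc d

sum1to : ℕ → (ℕ → ℕ) → ℕ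
sum1to zero f = 0
sum1to (suc s) f = sum1to s f + f (suc s)

{-# OPTIONS --safe #-}
-- For j ≥ 1, strong divisibility gives p^k ∣ C_j ⇔ α(p^k) ∣ j. Hence, as long as α(p^s) ∤ j,
-- ν_p(C_j) counts the k ≤ s with α(p^k) ∣ j; and once α(p^s) ∣ j, say j = m α(p^s), the
-- relation α(p^(s+i)) = p^i α(p^s) gives ν_p(C_j) = s + ν_p(m). Summing over j ≤ n, the first
-- kind of contribution adds up to Σ_{k ≤ s} ⌊n / α(p^k)⌋ and the extra ν_p(m) over the
-- multiples j = m α(p^s) ≤ n add up to ν_p(⌊n / α(p^s)⌋!).
module Submission where

open import Defs
open import Data.Nat
  using (ℕ; zero; suc; _+_; _*_; _^_; _∸_; _≤_; _<_; s≤s; z<s; NonZero; >-nonZero; nonTrivial⇒n>1)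
open import Data.Nat.Properties
open import Data.Nat.Divisibility
open import Data.Nat.DivMod
open import Data.Nat.GCD using (gcd; gcd[m,n]∣m; gcd[m,n]∣n; gcd-greatest; gcd[m,n]≢0)
open import Data.Nat.Primality using (Prime; euclidsLemma; prime⇒nonZero; prime⇒nonTrivial)
open import Data.Integer as ℤ using (ℤ; +_)
import Data.Integer.Properties as ℤ
open import Data.Product using (_×_; ∃-syntax; _,_; proj₁; proj₂)
open import Data.Sum using (inj₁; inj₂)
open import Function using (case_of_)
open import Function.Bundles using (_⇔_; mk⇔; Equivalence)
open import Relation.Nullary using (¬_; Dec; yes; no; contradiction)
open import Relation.Binary.PropositionalEquality
open import Data.Nat.Solver using (module +-*-Solver)
open +-*-Solver using (solve; _:+_; _:*_; _:=_)
open ≡-Reasoning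

private
  variable
    a b e i j k m n p s v x y : ℕ

𝟙 : {P : Set} → Dec P → ℕ
𝟙 (yes _) = 1
𝟙 (no _) = 0

𝟙-yes : {P : Set} (d : Dec P) → P → 𝟙 d ≡ 1
𝟙-yes (yes _) _ = refl
𝟙-yes (no ¬p) p = contradiction p ¬p

𝟙-no : {P : Set} (d : Dec P) → ¬ P → 𝟙 d ≡ 0
𝟙-no (yes p) ¬p = contradiction p ¬p
𝟙-no (no _) _ = refl

𝟙-cong : {P Q : Set} → P ⇔ Q → (d : Dec P) (d′ : Dec Q) → 𝟙 d ≡ 𝟙 d′
𝟙-cong _ (yes _) (yes _) = refl
𝟙-cong P⇔Q (yes p) (no ¬q) = contradiction (Equivalence.to P⇔Q p) ¬q
𝟙-cong P⇔Q (no ¬p) (yes q) = contradiction (Equivalence.from P⇔Q q) ¬p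
𝟙-cong _ (no _) (no _) = refl

sum1to-cong : ∀ s {f g : ℕ → ℕ} → (∀ k → 1 ≤ k → k ≤ s → f k ≡ g k) → sum1to s f ≡ sum1to s g
sum1to-cong zero _ = refl
sum1to-cong (suc s) f≗g =
  cong₂ _+_ (sum1to-cong s (λ k 1≤k k≤s → f≗g k 1≤k (m≤n⇒m≤1+n k≤s))) (f≗g (suc s) z<s ≤-refl)

sum1to-zero : ∀ s → sum1to s (λ _ → 0) ≡ 0
sum1to-zero zero = refl
sum1to-zero (suc s) = trans (+-identityʳ _) (sum1to-zero s)

sum1to-distrib-+ : ∀ s (f g : ℕ → ℕ) → sum1to s (λ k → f k + g k) ≡ sum1to s f + sum1to s g
sum1to-distrib-+ zero f g = refl
sum1to-distrib-+ (suc s) f g = begin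
  sum1to s (λ k → f k + g k) + (f (suc s) + g (suc s))
    ≡⟨ cong (_+ (f (suc s) + g (suc s))) (sum1to-distrib-+ s f g) ⟩
  (sum1to s f + sum1to s g) + (f (suc s) + g (suc s))
    ≡⟨ solve 4 (λ a b c d → (a :+ b) :+ (c :+ d) := (a :+ c) :+ (b :+ d)) refl
         (sum1to s f) (sum1to s g) (f (suc s)) (g (suc s)) ⟩
  (sum1to s f + f (suc s)) + (sum1to s g + g (suc s)) ∎

1+n≡[n/d]*d+[1+n%d] : ∀ n d .{{_ : NonZero d}} → suc n ≡ n / d * d + suc (n % d)
1+n≡[n/d]*d+[1+n%d] n d = begin
  suc n                     ≡⟨ cong suc (m≡m%n+[m/n]*n n d) ⟩
  suc (n % d + n / d * d)   ≡⟨ cong suc (+-comm (n % d) _) ⟩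
  suc (n / d * d + n % d)   ≡⟨ +-suc _ (n % d) ⟨
  n / d * d + suc (n % d)   ∎

fdiv-zeroˡ : ∀ d → fdiv 0 d ≡ 0
fdiv-zeroˡ zero = refl
fdiv-zeroˡ (suc d) = refl

fdiv[m,d]*d≡m : ∀ m d → 1 ≤ d → d ∣ m → fdiv m d * d ≡ m
fdiv[m,d]*d≡m m (suc d) _ = m/n*n≡m

-- Writing n = q d + r with r < d: d divides n + 1 exactly when r + 1 = d.
fdiv-suc-∣ : ∀ n d → 1 ≤ d → d ∣ suc n → fdiv (suc n) d ≡ suc (fdiv n d)
fdiv-suc-∣ n d@(suc _) _ d∣1+n = begin
  suc n / d             ≡⟨ /-congˡ (1+n≡[n/d]*d+[1+n%d] n d) ⟩
  (q * d + suc r) / d   ≡⟨ /-congˡ (cong (λ t → q * d + t) 1+r≡d) ⟩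
  (q * d + d) / d       ≡⟨ /-congˡ (+-comm (q * d) d) ⟩
  suc q * d / d         ≡⟨ m*n/n≡m (suc q) d ⟩
  suc q                 ∎
  where
  q r : ℕ
  q = n / d
  r = n % d
  d∣1+r : d ∣ suc r
  d∣1+r = ∣m+n∣m⇒∣n (subst (d ∣_) (1+n≡[n/d]*d+[1+n%d] n d) d∣1+n) (n∣m*n q)
  1+r≡d : suc r ≡ d
  1+r≡d = ≤-antisym (m%n<n n d) (∣⇒≤ d∣1+r)

fdiv-suc-∤ : ∀ n d → 1 ≤ d → ¬ d ∣ suc n → fdiv (suc n) d ≡ fdiv n d
fdiv-suc-∤ n d@(suc _) _ d∤1+n with m≤n⇒m<n∨m≡n (m%n<n n d)
... | inj₁ 1+r<d = begin
  suc n / d                           ≡⟨ /-congˡ (1+n≡[n/d]*d+[1+n%d] n d) ⟩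
  (n / d * d + suc (n % d)) / d       ≡⟨ +-distrib-/-∣ˡ (suc (n % d)) (n∣m*n (n / d)) ⟩
  n / d * d / d + suc (n % d) / d     ≡⟨ cong₂ _+_ (m*n/n≡m (n / d) d) (m<n⇒m/n≡0 1+r<d) ⟩
  n / d + 0                           ≡⟨ +-identityʳ _ ⟩
  n / d                               ∎
... | inj₂ 1+r≡d = contradiction (divides (suc (n / d)) 1+n≡[1+q]*d) d∤1+n
  where
  1+n≡[1+q]*d : suc n ≡ suc (n / d) * d
  1+n≡[1+q]*d = trans (1+n≡[n/d]*d+[1+n%d] n d)
                  (trans (cong (λ t → n / d * d + t) 1+r≡d) (+-comm (n / d * d) d))

fdiv-suc : ∀ n d → 1 ≤ d → fdiv (suc n) d ≡ fdiv n d + 𝟙 (d ∣? suc n)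
fdiv-suc n d 1≤d with d ∣? suc n
... | yes d∣1+n = trans (fdiv-suc-∣ n d 1≤d d∣1+n) (+-comm 1 _)
... | no d∤1+n = trans (fdiv-suc-∤ n d 1≤d d∤1+n) (sym (+-identityʳ _))

-- A record rather than a product, so that the exponent v is inferable (p ^_ is not injective).
record IsValuationℕ (p x v : ℕ) : Set where
  constructor mkValuation
  field
    pow∣ : p ^ v ∣ x
    pow-suc∤ : ¬ (p ^ suc v ∣ x)

-- ℤ-divisibility is divisibility of absolute values.
toIsValuation : ∀ z → IsValuationℕ p ℤ.∣ z ∣ v → IsValuation p z v
toIsValuation _ (mkValuation p^v∣z p^[1+v]∤z) = p^v∣z , p^[1+v]∤z

valuation-* : Prime p → IsValuationℕ p x a → IsValuationℕ p y b → IsValuationℕ p (x * y) (a + b)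
valuation-* {p} {a = a} {b = b} pr
  (mkValuation (divides x′ refl) p^[1+a]∤x) (mkValuation (divides y′ refl) p^[1+b]∤y) =
  mkValuation (subst (p ^ (a + b) ∣_) (sym xy≡) (n∣m*n (x′ * y′))) p^[1+a+b]∤xy
  where
  instance
    p^[a+b]≢0 : NonZero (p ^ (a + b))
    p^[a+b]≢0 = m^n≢0 p (a + b) {{prime⇒nonZero pr}}
  xy≡ : x′ * p ^ a * (y′ * p ^ b) ≡ x′ * y′ * p ^ (a + b)
  xy≡ = begin
    x′ * p ^ a * (y′ * p ^ b)   ≡⟨ solve 4 (λ x′ u y′ v → x′ :* u :* (y′ :* v) := x′ :* y′ :* (u :* v))
                                      refl x′ (p ^ a) y′ (p ^ b) ⟩
    x′ * y′ * (p ^ a * p ^ b)   ≡⟨ cong (x′ * y′ *_) (^-distribˡ-+-* p a b) ⟨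
    x′ * y′ * p ^ (a + b)       ∎
  p^[1+a+b]∤xy : ¬ (p ^ suc (a + b) ∣ x′ * p ^ a * (y′ * p ^ b))
  p^[1+a+b]∤xy h
    with euclidsLemma x′ y′ pr (*-cancelʳ-∣ (p ^ (a + b)) (subst (p * p ^ (a + b) ∣_) xy≡ h))
  ... | inj₁ p∣x′ = p^[1+a]∤x (*-monoˡ-∣ (p ^ a) p∣x′)
  ... | inj₂ p∣y′ = p^[1+b]∤y (*-monoˡ-∣ (p ^ b) p∣y′)

valuation-1 : 1 < p → IsValuationℕ p 1 0
valuation-1 {p} 1<p =
  mkValuation ∣-refl (λ p*1∣1 → >⇒≢ 1<p (trans (sym (*-identityʳ p)) (∣1⇒≡1 p*1∣1)))

powerCount : ℕ → ℕ → ℕ → ℕ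
powerCount p s x = sum1to s (λ k → 𝟙 (p ^ k ∣? x))

p^s∣x⇒powerCount≡s : ∀ s → p ^ s ∣ x → powerCount p s x ≡ s
p^s∣x⇒powerCount≡s zero _ = refl
p^s∣x⇒powerCount≡s {p} {x} (suc s) p^[1+s]∣x = begin
  powerCount p s x + 𝟙 (p ^ suc s ∣? x)
    ≡⟨ cong₂ _+_ (p^s∣x⇒powerCount≡s s (∣-trans (n∣m*n p) p^[1+s]∣x)) (𝟙-yes _ p^[1+s]∣x) ⟩
  s + 1 ≡⟨ +-comm s 1 ⟩
  suc s ∎

powerCount-suc-∤ : ¬ (p ^ suc s ∣ x) → powerCount p (suc s) x ≡ powerCount p s x
powerCount-suc-∤ {p} {s} {x} p^[1+s]∤x =
  trans (cong (λ t → powerCount p s x + t) (𝟙-no _ p^[1+s]∤x)) (+-identityʳ _)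

powerCount-isValuation : ∀ s → ¬ (p ^ suc s ∣ x) → IsValuationℕ p x (powerCount p s x)
powerCount-isValuation {p} {x} zero p∤x = mkValuation (1∣ x) p∤x
powerCount-isValuation {p} {x} (suc s) p^[2+s]∤x = case p ^ suc s ∣? x of λ where
  (yes p^[1+s]∣x) → subst (IsValuationℕ p x) (sym (p^s∣x⇒powerCount≡s (suc s) p^[1+s]∣x))
                      (mkValuation p^[1+s]∣x p^[2+s]∤x)
  (no p^[1+s]∤x) → subst (IsValuationℕ p x) (sym (powerCount-suc-∤ {p} {s} p^[1+s]∤x))
                      (powerCount-isValuation s p^[1+s]∤x)

n<m^n : ∀ {m} n → 1 < m → n < m ^ n
n<m^n zero _ = z<s
n<m^n {m@(suc _)} (suc n) 1<m =
  subst (suc n <_) (*-comm (m ^ n) m) (≤-<-trans (n<m^n n 1<m) (m<m*n (m ^ n) m {{m^n≢0 m n}} 1<m))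

valuation-exists : 1 < p → ∀ x .{{_ : NonZero x}} → ∃[ v ] IsValuationℕ p x v
valuation-exists {p} 1<p x = powerCount p x x , powerCount-isValuation x p^[1+x]∤x
  where
  p^[1+x]∤x : ¬ (p ^ suc x ∣ x)
  p^[1+x]∤x h = <⇒≱ (<-trans (n<1+n x) (n<m^n (suc x) 1<p)) (∣⇒≤ h)

valuation-corial-suc : (C : ℕ → ℤ) → Prime p →
  IsValuationℕ p ℤ.∣ C (suc n) ∣ a → IsValuationℕ p ℤ.∣ corial C n ∣ b →
  IsValuationℕ p ℤ.∣ corial C (suc n) ∣ (a + b)
valuation-corial-suc {p = p} {n = n} {a = a} {b = b} C pr ν[Cₙ₊₁] ν[n!] =
  subst (λ x → IsValuationℕ p x (a + b)) (sym (ℤ.abs-* (C (suc n)) (corial C n)))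
    (valuation-* pr ν[Cₙ₊₁] ν[n!])

module StrongDivisibilitySequence {C : ℕ → ℤ} (sds : IsStrongDivSeq C) where

  ∣C∣ : ℕ → ℕ
  ∣C∣ j = ℤ.∣ C j ∣

  gcd-∣C∣ : 1 ≤ i → 1 ≤ j → gcd (∣C∣ i) (∣C∣ j) ≡ ∣C∣ (gcd i j)
  gcd-∣C∣ 1≤i 1≤j = ℤ.+-injective (proj₂ sds _ _ 1≤i 1≤j)

  ∣C∣-mono-∣ : 1 ≤ i → 1 ≤ j → i ∣ j → ∣C∣ i ∣ ∣C∣ j
  ∣C∣-mono-∣ {i} {j} 1≤i 1≤j i∣j = subst (_∣ ∣C∣ j) gcd≡C[i] (gcd[m,n]∣n (∣C∣ i) (∣C∣ j))
    where
    gcd≡C[i] : gcd (∣C∣ i) (∣C∣ j) ≡ ∣C∣ i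
    gcd≡C[i] = trans (gcd-∣C∣ 1≤i 1≤j)
                     (cong ∣C∣ (∣-antisym (gcd[m,n]∣m i j) (gcd-greatest ∣-refl i∣j)))

  rank∣⇒∣C : IsRankOfApparition C m a → 1 ≤ j → a ∣ j → m ∣ ∣C∣ j
  rank∣⇒∣C (1≤a , m∣C[a] , _) 1≤j a∣j = ∣-trans m∣C[a] (∣C∣-mono-∣ 1≤a 1≤j a∣j)

  -- gcd(a, j) is an index ≤ a at which m ∣ C, so minimality of the rank a forces gcd(a, j) = a.
  ∣C⇒rank∣ : IsRankOfApparition C m a → 1 ≤ j → m ∣ ∣C∣ j → a ∣ j
  ∣C⇒rank∣ {m} {a} {j} (1≤a , m∣C[a] , minimal) 1≤j m∣C[j]
    with m≤n⇒m<n∨m≡n (∣⇒≤ {{>-nonZero 1≤a}} (gcd[m,n]∣m a j))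
  ... | inj₂ gcd≡a = subst (_∣ j) gcd≡a (gcd[m,n]∣n a j)
  ... | inj₁ gcd<a = contradiction m∣C[gcd] (minimal (gcd a j) 1≤gcd gcd<a)
    where
    1≤gcd : 1 ≤ gcd a j
    1≤gcd = n≢0⇒n>0 (gcd[m,n]≢0 a j (inj₂ (m<n⇒n≢0 1≤j)))
    m∣C[gcd] : m ∣ ∣C∣ (gcd a j)
    m∣C[gcd] = subst (m ∣_) (gcd-∣C∣ 1≤a 1≤j) (gcd-greatest m∣C[a] m∣C[j])

  rank∣⇔∣C : IsRankOfApparition C m a → 1 ≤ j → a ∣ j ⇔ m ∣ ∣C∣ j
  rank∣⇔∣C rank 1≤j = mk⇔ (rank∣⇒∣C rank 1≤j) (∣C⇒rank∣ rank 1≤j)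

module AcceptablePrime
  {C : ℕ → ℤ} (sds : IsStrongDivSeq C) {p : ℕ} (pr : Prime p) {α : ℕ → ℕ}
  (rank : ∀ k → 1 ≤ k → IsRankOfApparition C (p ^ k) (α k))
  {s : ℕ} (1≤s : 1 ≤ s) (α-step : ∀ k → s < k → α k ≡ p * α (k ∸ 1)) where

  open StrongDivisibilitySequence sds

  1<p : 1 < p
  1<p = nonTrivial⇒n>1 p {{prime⇒nonTrivial pr}}

  1≤α : 1 ≤ k → 1 ≤ α k
  1≤α {k} 1≤k = proj₁ (rank k 1≤k)

  α[s+i]≡p^i*α[s] : ∀ i → α (s + i) ≡ p ^ i * α s
  α[s+i]≡p^i*α[s] zero = trans (cong α (+-identityʳ s)) (sym (*-identityˡ (α s)))
  α[s+i]≡p^i*α[s] (suc i) = begin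
    α (s + suc i)      ≡⟨ cong α (+-suc s i) ⟩
    α (suc (s + i))    ≡⟨ α-step (suc (s + i)) (s≤s (m≤m+n s i)) ⟩
    p * α (s + i)      ≡⟨ cong (p *_) (α[s+i]≡p^i*α[s] i) ⟩
    p * (p ^ i * α s)  ≡⟨ *-assoc p (p ^ i) (α s) ⟨
    p ^ suc i * α s    ∎

  p^[s+i]∣C⇔p^i∣m : 1 ≤ m → p ^ (s + i) ∣ ∣C∣ (m * α s) ⇔ p ^ i ∣ m
  p^[s+i]∣C⇔p^i∣m {m} {i} 1≤m = mk⇔ to from
    where
    instance
      α[s]≢0 : NonZero (α s)
      α[s]≢0 = >-nonZero (1≤α 1≤s)
    1≤s+i : 1 ≤ s + i
    1≤s+i = ≤-trans 1≤s (m≤m+n s i)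
    1≤j : 1 ≤ m * α s
    1≤j = *-mono-≤ 1≤m (1≤α 1≤s)
    to : p ^ (s + i) ∣ ∣C∣ (m * α s) → p ^ i ∣ m
    to h = *-cancelʳ-∣ (α s)
      (subst (_∣ m * α s) (α[s+i]≡p^i*α[s] i) (∣C⇒rank∣ (rank (s + i) 1≤s+i) 1≤j h))
    from : p ^ i ∣ m → p ^ (s + i) ∣ ∣C∣ (m * α s)
    from h = rank∣⇒∣C (rank (s + i) 1≤s+i) 1≤j
      (subst (_∣ m * α s) (sym (α[s+i]≡p^i*α[s] i)) (*-monoˡ-∣ (α s) h))

  valuation-C-multiple : 1 ≤ m → IsValuationℕ p m e → IsValuationℕ p (∣C∣ (m * α s)) (s + e)
  valuation-C-multiple {m} {e} 1≤m (mkValuation p^e∣m p^[1+e]∤m) =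
    mkValuation (Equivalence.from (p^[s+i]∣C⇔p^i∣m 1≤m) p^e∣m) p^[1+s+e]∤C
    where
    p^[1+s+e]∤C : ¬ (p ^ suc (s + e) ∣ ∣C∣ (m * α s))
    p^[1+s+e]∤C h = p^[1+e]∤m (Equivalence.to (p^[s+i]∣C⇔p^i∣m 1≤m)
      (subst (λ t → p ^ t ∣ ∣C∣ (m * α s)) (sym (+-suc s e)) h))

  ranksDividing : ℕ → ℕ
  ranksDividing j = sum1to s (λ k → 𝟙 (α k ∣? j))

  ranksDividing≡powerCount : 1 ≤ j → ranksDividing j ≡ powerCount p s (∣C∣ j)
  ranksDividing≡powerCount 1≤j = sum1to-cong s (λ k 1≤k _ → 𝟙-cong (rank∣⇔∣C (rank k 1≤k) 1≤j) _ _)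

  ranksDividing-multiple : 1 ≤ j → α s ∣ j → ranksDividing j ≡ s
  ranksDividing-multiple 1≤j α[s]∣j =
    trans (ranksDividing≡powerCount 1≤j) (p^s∣x⇒powerCount≡s s (rank∣⇒∣C (rank s 1≤s) 1≤j α[s]∣j))

  valuation-C-non-multiple : 1 ≤ j → ¬ α s ∣ j → IsValuationℕ p (∣C∣ j) (ranksDividing j)
  valuation-C-non-multiple {j} 1≤j α[s]∤j =
    subst (IsValuationℕ p (∣C∣ j)) (sym (ranksDividing≡powerCount 1≤j))
      (powerCount-isValuation s p^[1+s]∤C[j])
    where
    p^[1+s]∤C[j] : ¬ (p ^ suc s ∣ ∣C∣ j)
    p^[1+s]∤C[j] h = α[s]∤j (∣-trans (n∣m*n p)
      (subst (_∣ j) (α-step (suc s) ≤-refl) (∣C⇒rank∣ (rank (suc s) z<s) 1≤j h)))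

  floorSum : ℕ → ℕ
  floorSum n = sum1to s (λ k → fdiv n (α k))

  floorSum-zero : floorSum 0 ≡ 0
  floorSum-zero = trans (sum1to-cong s (λ k _ _ → fdiv-zeroˡ (α k))) (sum1to-zero s)

  floorSum-suc : ∀ n → floorSum (suc n) ≡ floorSum n + ranksDividing (suc n)
  floorSum-suc n =
    trans (sum1to-cong s (λ k 1≤k _ → fdiv-suc n (α k) (1≤α 1≤k))) (sum1to-distrib-+ s _ _)

  valuation-corial-suc-∤ : ¬ α s ∣ suc n → IsValuationℕ p ℤ.∣ corial C n ∣ (floorSum n + v) →
                           IsValuationℕ p ℤ.∣ corial C (suc n) ∣ (floorSum (suc n) + v)
  valuation-corial-suc-∤ {n} {v} α[s]∤1+n ν[Cₙ!] =
    subst (IsValuationℕ p _) exponent≡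
      (valuation-corial-suc C pr (valuation-C-non-multiple z<s α[s]∤1+n) ν[Cₙ!])
    where
    exponent≡ : ranksDividing (suc n) + (floorSum n + v) ≡ floorSum (suc n) + v
    exponent≡ = begin
      ranksDividing (suc n) + (floorSum n + v)   ≡⟨ solve 3 (λ r f v → r :+ (f :+ v) := f :+ r :+ v)
                                                       refl (ranksDividing (suc n)) (floorSum n) v ⟩
      floorSum n + ranksDividing (suc n) + v     ≡⟨ cong (_+ v) (floorSum-suc n) ⟨
      floorSum (suc n) + v                       ∎

  valuation-corial-suc-∣ : α s ∣ suc n → IsValuationℕ p (suc (fdiv n (α s))) e →
                           IsValuationℕ p ℤ.∣ corial C n ∣ (floorSum n + v) →
                           IsValuationℕ p ℤ.∣ corial C (suc n) ∣ (floorSum (suc n) + (e + v))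
  valuation-corial-suc-∣ {n} {e} {v} α[s]∣1+n ν[1+q] ν[Cₙ!] =
    subst (IsValuationℕ p _) exponent≡ (valuation-corial-suc C pr ν[Cₙ₊₁] ν[Cₙ!])
    where
    [1+q]*α[s]≡1+n : suc (fdiv n (α s)) * α s ≡ suc n
    [1+q]*α[s]≡1+n = trans (cong (_* α s) (sym (fdiv-suc-∣ n (α s) (1≤α 1≤s) α[s]∣1+n)))
                           (fdiv[m,d]*d≡m (suc n) (α s) (1≤α 1≤s) α[s]∣1+n)
    ν[Cₙ₊₁] : IsValuationℕ p (∣C∣ (suc n)) (s + e)
    ν[Cₙ₊₁] = subst (λ j → IsValuationℕ p (∣C∣ j) (s + e)) [1+q]*α[s]≡1+n
                    (valuation-C-multiple z<s ν[1+q])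
    exponent≡ : s + e + (floorSum n + v) ≡ floorSum (suc n) + (e + v)
    exponent≡ = begin
      s + e + (floorSum n + v)
        ≡⟨ solve 4 (λ s e f v → s :+ e :+ (f :+ v) := f :+ s :+ (e :+ v)) refl s e (floorSum n) v ⟩
      floorSum n + s + (e + v)
        ≡⟨ cong (λ r → floorSum n + r + (e + v)) (ranksDividing-multiple z<s α[s]∣1+n) ⟨
      floorSum n + ranksDividing (suc n) + (e + v)
        ≡⟨ cong (_+ (e + v)) (floorSum-suc n) ⟨
      floorSum (suc n) + (e + v) ∎

  valuation-corial : ∀ n → ∃[ v ] (IsValuationℕ p (fact (fdiv n (α s))) v ×
                                   IsValuationℕ p ℤ.∣ corial C n ∣ (floorSum n + v))
  valuation-corial zero =
    0 , subst (λ q → IsValuationℕ p (fact q) 0) (sym (fdiv-zeroˡ (α s))) (valuation-1 1<p)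
      , subst (IsValuationℕ p 1) (cong (_+ 0) (sym floorSum-zero)) (valuation-1 1<p)
  valuation-corial (suc n) with valuation-corial n | α s ∣? suc n
  ... | v , ν[q!] , ν[Cₙ!] | no α[s]∤1+n =
    v , subst (λ q → IsValuationℕ p (fact q) v) (sym (fdiv-suc-∤ n (α s) (1≤α 1≤s) α[s]∤1+n)) ν[q!]
      , valuation-corial-suc-∤ α[s]∤1+n ν[Cₙ!]
  ... | v , ν[q!] , ν[Cₙ!] | yes α[s]∣1+n =
    let e , ν[1+q] = valuation-exists 1<p (suc (fdiv n (α s))) in
    e + v , subst (λ q → IsValuationℕ p (fact q) (e + v)) (sym (fdiv-suc-∣ n (α s) (1≤α 1≤s) α[s]∣1+n))
                  (valuation-* pr ν[1+q] ν[q!])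
          , valuation-corial-suc-∣ α[s]∣1+n ν[1+q] ν[Cₙ!]

lemma4p1 : (C : ℕ → ℤ) → IsStrongDivSeq C →
    (p : ℕ) → Prime p →
    (α : ℕ → ℕ) → ((k : ℕ) → 1 ≤ k → IsRankOfApparition C (p ^ k) (α k)) →
    (s : ℕ) → 1 ≤ s →
    ((k : ℕ) → 2 ≤ k → k ≤ s → α (k ∸ 1) ∣ α k) →
    ((k : ℕ) → s < k → α k ≡ p * α (k ∸ 1)) →
    (n : ℕ) →
    ∃[ v ] (IsValuation p (+ fact (fdiv n (α s))) v ×
            IsValuation p (corial C n) (sum1to s (λ k → fdiv n (α k)) + v))
lemma4p1 C sds p pr α rank s 1≤s _ α-step n =
  let v , ν[q!] , ν[Cₙ!] = AcceptablePrime.valuation-corial sds pr rank 1≤s α-step n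
  in v , toIsValuation (+ _) ν[q!] , toIsValuation (corial C n) ν[Cₙ!]
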